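{- Let $f,g:\omega\to\omega$ with $0<g(k)<f(k)$ for all $k$, and let $0=n_0<n_1<n_2<\cdots$ be natural numbers. Define $f'(i):=\prod_{n_i\le k<n_{i+1}}f(k)$ and $g'(i):=\prod_{n_i\le k<n_{i+1}}g(k)$. Then $\mathfrak{c}(f',g')\le\mathfrak{c}(f,g)$.
   Context: For $g:\omega\to\omega$ with all values $\ge 1$, a $g$-slalom is a sequence $\bar B=\langle B_k:k\in\omega\rangle$ of sets $B_k\subseteq\omega$ with $|B_k|=g(k)$; a function $h:\omega\to\omega$ is in $\bar B$ if $h(k)\in B_k$ for all $k$. For $f,g:\omega\to\omega$ with positive values, $\mathfrak{c}(f,g)$ is the least cardinality of a family of $g$-slaloms such that every $h$ with $h(k)<f(k)$ for all $k$ is in some member of the family. -}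

module Defs where

open import Data.Nat using (ℕ; zero; suc; _*_; _∸_; _<_)
open import Data.Fin using (Fin)
open import Data.Product using (Σ; ∃; _×_)
open import Function.Definitions using (Injective)
open import Relation.Binary.PropositionalEquality using (_≡_)

-- A g-slalom: a sequence ⟨B_k⟩ with B_k ⊆ ω of cardinality exactly g(k).
-- B_k is represented as the image of an injective map Fin (g k) → ℕ.
record Slalom (g : ℕ → ℕ) : Set where
  field
    set   : (k : ℕ) → Fin (g k) → ℕ
    inj   : (k : ℕ) → Injective _≡_ _≡_ (set k)
open Slalom public

_∈Sl_ : {g : ℕ → ℕ} → (ℕ → ℕ) → Slalom g → Set
h ∈Sl B = (k : ℕ) → ∃ λ (j : Fin _) → set B k j ≡ h k

Bounded : (ℕ → ℕ) → (ℕ → ℕ) → Set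
Bounded f h = (k : ℕ) → h k < f k

Covers : (f g : ℕ → ℕ) {I : Set} → (I → Slalom g) → Set
Covers f g {I} S = (h : ℕ → ℕ) → Bounded f h → ∃ λ (i : I) → h ∈Sl S i

prodFrom : (ℕ → ℕ) → ℕ → ℕ → ℕ
prodFrom f a zero    = 1
prodFrom f a (suc l) = f a * prodFrom f (suc a) l

blockProd : (ℕ → ℕ) → (ℕ → ℕ) → ℕ → ℕ
blockProd f n i = prodFrom f (n i) (n (suc i) ∸ n i)

-- 𝔠(f',g') ≤ 𝔠(f,g), phrased without cardinals: every covering family of
-- g-slaloms (indexed by any I) yields a covering family of g'-slaloms indexed
-- by some J admitting an injection into I.
CLe : (f' g' f g : ℕ → ℕ) → Set₁
CLe f' g' f g =
  (I : Set) (S : I → Slalom g) → Covers f g S →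
  Σ Set λ J → Σ (J → I) λ ι → Injective _≡_ _≡_ ι ×
    Σ (J → Slalom g') λ S' → Covers f' g' S'

-- Read f'(i) = ∏_{n_i ≤ k < n_{i+1}} f(k) as a mixed radix: a function h' < f' decodes
-- into a digit function h < f, with h(k) the digit of h'(i) at position k of block i.
-- If a g-slalom B catches h, then h'(i) is the code of a tuple drawn from B_k for
-- n_i ≤ k < n_{i+1}; there are exactly g'(i) such tuples, so coding them (and padding the
-- codes of tuples that are not digit strings with fresh values) gives a g'-slalom B'
-- catching h'. B ↦ B' keeps the index set of a covering family.
module Submission where

open import Defs
open import Data.Nat using (ℕ; zero; suc; _+_; _*_; _∸_; _≤_; _<_; _≤′_; ≤′-refl; ≤′-step; z≤n; s≤s; _<?_)
open import Data.Nat.Properties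
open import Data.Fin as Fin using (Fin; toℕ; fromℕ<; combine; quotient; remainder)
open import Data.Fin.Properties using (toℕ<n; toℕ-injective; toℕ-fromℕ<; fromℕ<-toℕ; remQuot-combine; combine-remQuot)
open import Data.Maybe using (Maybe; just; nothing; maybe′; zipWith)
open import Data.Product using (∃; _×_; _,_; proj₁; proj₂)
open import Function using (id; _∘_)
open import Function.Definitions using (Injective)
open import Relation.Nullary using (yes; no; contradiction)
open import Relation.Binary.Definitions using (tri<; tri≈; tri>)
open import Relation.Binary.PropositionalEquality

PartialInjective : {A B : Set} → (A → Maybe B) → Set
PartialInjective φ = ∀ {x y c} → φ x ≡ just c → φ y ≡ just c → x ≡ y

fromℕ? : (m v : ℕ) → Maybe (Fin m)
fromℕ? m v with v <? m
... | yes v<m = just (fromℕ< v<m)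
... | no _    = nothing

toℕ-fromℕ? : ∀ {m v c} → fromℕ? m v ≡ just c → toℕ c ≡ v
toℕ-fromℕ? {m} {v} e with v <? m
toℕ-fromℕ? refl | yes v<m = toℕ-fromℕ< v<m

fromℕ?-toℕ : ∀ {m} (c : Fin m) → fromℕ? m (toℕ c) ≡ just c
fromℕ?-toℕ {m} c with toℕ c <? m
... | yes c<m = cong just (fromℕ<-toℕ c c<m)
... | no c≮m  = contradiction (toℕ<n c) c≮m

module _ {m m′ k k′ : ℕ} where

  _⊠_ : (Fin m → Maybe (Fin m′)) → (Fin k → Maybe (Fin k′)) → Fin (m * k) → Maybe (Fin (m′ * k′))
  (φ ⊠ ψ) j = zipWith combine (φ (quotient {m} k j)) (ψ (remainder {m} k j))

  ⊠-combine : ∀ {φ ψ x y u v} → φ x ≡ just u → ψ y ≡ just v →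
              (φ ⊠ ψ) (combine x y) ≡ just (combine u v)
  ⊠-combine {φ} {ψ} {x} {y} φx ψy =
    trans (cong (λ (x′ , y′) → zipWith combine (φ x′) (ψ y′)) (remQuot-combine x y))
          (cong₂ (zipWith combine) φx ψy)

  ⊠-just⁻¹ : ∀ {φ ψ j c} → (φ ⊠ ψ) j ≡ just c →
             φ (quotient {m} k j) ≡ just (quotient {m′} k′ c) ×
             ψ (remainder {m} k j) ≡ just (remainder {m′} k′ c)
  ⊠-just⁻¹ {φ} {ψ} {j} e with φ (quotient {m} k j) | ψ (remainder {m} k j)
  ⊠-just⁻¹ refl | just u | just v = cong (just ∘ proj₁) (sym (remQuot-combine u v))
                                  , cong (just ∘ proj₂) (sym (remQuot-combine u v))

  ⊠-partialInjective : ∀ {φ ψ} → PartialInjective φ → PartialInjective ψ → PartialInjective (φ ⊠ ψ)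
  ⊠-partialInjective {φ} {ψ} φ-inj ψ-inj {j₁} {j₂} e₁ e₂ = begin
    j₁                                                   ≡⟨ combine-remQuot {m} k j₁ ⟨
    combine (quotient {m} k j₁) (remainder {m} k j₁)     ≡⟨ cong₂ combine (φ-inj q₁ q₂) (ψ-inj r₁ r₂) ⟩
    combine (quotient {m} k j₂) (remainder {m} k j₂)     ≡⟨ combine-remQuot {m} k j₂ ⟩
    j₂                                                   ∎
    where
    open ≡-Reasoning
    q₁ = proj₁ (⊠-just⁻¹ {φ} {ψ} e₁); r₁ = proj₂ (⊠-just⁻¹ {φ} {ψ} e₁)
    q₂ = proj₁ (⊠-just⁻¹ {φ} {ψ} e₂); r₂ = proj₂ (⊠-just⁻¹ {φ} {ψ} e₂)

module _ {A : Set} {N : ℕ} (φ : A → Maybe (Fin N)) (tag : A → ℕ) where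

  padded : A → ℕ
  padded a = maybe′ toℕ (N + tag a) (φ a)

  padded-injective : PartialInjective φ → Injective _≡_ _≡_ tag → Injective _≡_ _≡_ padded
  padded-injective φ-inj tag-inj {a} {b} e with φ a in φa | φ b in φb
  ... | just u  | just v  = φ-inj φa (trans φb (cong just (sym (toℕ-injective e))))
  ... | just u  | nothing = contradiction (subst (_< N) e (toℕ<n u)) (≤⇒≯ (m≤m+n N (tag b)))
  ... | nothing | just v  = contradiction (subst (_< N) (sym e) (toℕ<n v)) (≤⇒≯ (m≤m+n N (tag a)))
  ... | nothing | nothing = tag-inj (+-cancelˡ-≡ N _ _ e)

blockLength : (ℕ → ℕ) → ℕ → ℕ
blockLength n i = n (suc i) ∸ n i

module Blocks (n : ℕ → ℕ) (n-zero : n 0 ≡ 0) (n-strict : ∀ i → n i < n (suc i)) where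

  n-mono : ∀ {i j} → i ≤ j → n i ≤ n j
  n-mono = go ∘ ≤⇒≤′
    where
    go : ∀ {i j} → i ≤′ j → n i ≤ n j
    go ≤′-refl       = ≤-refl
    go (≤′-step i≤j) = ≤-trans (go i≤j) (<⇒≤ (n-strict _))

  block : ℕ → ℕ
  block zero = 0
  block (suc k) with suc k <? n (suc (block k))
  ... | yes _ = block k
  ... | no _  = suc (block k)

  block-bounds : ∀ k → n (block k) ≤ k × k < n (suc (block k))
  block-bounds zero = ≤-reflexive n-zero , subst (_< n 1) n-zero (n-strict 0)
  block-bounds (suc k) with suc k <? n (suc (block k)) | block-bounds k
  ... | yes k+1<next | lo , _  = m≤n⇒m≤1+n lo , k+1<next
  ... | no k+1≮next  | _ , hi  = ≮⇒≥ k+1≮next , subst (_< n (suc (suc (block k)))) next≡k+1 (n-strict _)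
    where
    next≡k+1 : n (suc (block k)) ≡ suc k
    next≡k+1 = ≤-antisym (≮⇒≥ k+1≮next) hi

  block-unique : ∀ {i k} → n i ≤ k → k < n (suc i) → block k ≡ i
  block-unique {i} {k} lo hi with <-cmp (block k) i | block-bounds k
  ... | tri< b<i _ _ | _ , hi′ = contradiction (≤-<-trans (n-mono b<i) (≤-<-trans lo hi′)) (<-irrefl refl)
  ... | tri≈ _ b≡i _ | _       = b≡i
  ... | tri> _ _ i<b | lo′ , _ = contradiction (≤-<-trans (≤-trans (n-mono i<b) lo′) hi) (<-irrefl refl)

  offset-in-block : ∀ {i t} → t < blockLength n i → n i + t < n (suc i)
  offset-in-block {i} t<l = subst (n i + _ <_) (m+[n∸m]≡n (<⇒≤ (n-strict i))) (+-monoʳ-< (n i) t<l)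

digit : (f : ℕ → ℕ) (a l : ℕ) → Fin (prodFrom f a l) → ℕ → ℕ
digit f a zero    c t       = 0
digit f a (suc l) c zero    = toℕ (quotient {f a} (prodFrom f (suc a) l) c)
digit f a (suc l) c (suc t) = digit f (suc a) l (remainder {f a} (prodFrom f (suc a) l) c) t

digit-< : ∀ f a l c {t} → t < l → digit f a l c t < f (a + t)
digit-< f a (suc l) c {zero}  _         =
  subst (λ k → digit f a (suc l) c 0 < f k) (sym (+-identityʳ a)) (toℕ<n _)
digit-< f a (suc l) c {suc t} (s≤s t<l) =
  subst (λ k → digit f a (suc l) c (suc t) < f k) (sym (+-suc a t)) (digit-< f (suc a) l _ t<l)

_∈_at_ : {g : ℕ → ℕ} → ℕ → Slalom g → ℕ → Set
v ∈ B at k = ∃ λ x → set B k x ≡ v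

module _ {g : ℕ → ℕ} (B : Slalom g) (f : ℕ → ℕ) where

  slot : (k : ℕ) → Fin (g k) → Maybe (Fin (f k))
  slot k = fromℕ? (f k) ∘ set B k

  slot-partialInjective : ∀ k → PartialInjective (slot k)
  slot-partialInjective k e₁ e₂ = inj B k (trans (sym (toℕ-fromℕ? e₁)) (toℕ-fromℕ? e₂))

  encode : (a l : ℕ) → Fin (prodFrom g a l) → Maybe (Fin (prodFrom f a l))
  encode a zero    _ = just Fin.zero
  encode a (suc l)   = slot a ⊠ encode (suc a) l

  encode-partialInjective : ∀ a l → PartialInjective (encode a l)
  encode-partialInjective a zero    {Fin.zero} {Fin.zero} _ _ = refl
  encode-partialInjective a (suc l) =
    ⊠-partialInjective {φ = slot a} (slot-partialInjective a) (encode-partialInjective (suc a) l)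

  encode-onto : ∀ a l c → (∀ {t} → t < l → digit f a l c t ∈ B at (a + t)) →
                ∃ λ j → encode a l j ≡ just c
  encode-onto a zero    Fin.zero _    = Fin.zero , refl
  encode-onto a (suc l) c        hits = combine x y , (begin
    encode a (suc l) (combine x y)  ≡⟨ ⊠-combine {φ = slot a} {encode (suc a) l} slot-x encode-y ⟩
    just (combine u v)              ≡⟨ cong just (combine-remQuot {f a} _ c) ⟩
    just c                          ∎)
    where
    open ≡-Reasoning
    u = quotient {f a} (prodFrom f (suc a) l) c
    v = remainder {f a} (prodFrom f (suc a) l) c
    u∈B : toℕ u ∈ B at a
    u∈B = subst (toℕ u ∈ B at_) (+-identityʳ a) (hits (s≤s z≤n))
    x = proj₁ u∈B
    slot-x : slot a x ≡ just u
    slot-x = trans (cong (fromℕ? (f a)) (proj₂ u∈B)) (fromℕ?-toℕ u)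
    v-onto = encode-onto (suc a) l v λ {t} t<l →
      subst (digit f (suc a) l v t ∈ B at_) (+-suc a t) (hits (s≤s t<l))
    y = proj₁ v-onto
    encode-y = proj₂ v-onto

blockSlalom : {g : ℕ → ℕ} (f n : ℕ → ℕ) → Slalom g → Slalom (blockProd g n)
set (blockSlalom f n B) i = padded (encode B f (n i) (blockLength n i)) toℕ
inj (blockSlalom f n B) i =
  padded-injective (encode B f (n i) (blockLength n i)) toℕ
                   (encode-partialInjective B f (n i) (blockLength n i)) toℕ-injective

blockSlalom-∋ : ∀ {g} f n (B : Slalom g) i (c : Fin (blockProd f n i)) →
                (∀ {t} → t < blockLength n i → digit f (n i) (blockLength n i) c t ∈ B at (n i + t)) →
                toℕ c ∈ blockSlalom f n B at i
blockSlalom-∋ f n B i c hits = let (j , e) = encode-onto B f (n i) _ c hits in j , cong (maybe′ toℕ _) e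

module _ (f n : ℕ → ℕ) (n-zero : n 0 ≡ 0) (n-strict : ∀ i → n i < n (suc i)) where

  open Blocks n n-zero n-strict

  module _ (h′ : ℕ → ℕ) (h′<f′ : Bounded (blockProd f n) h′) where

    unblock : ℕ → ℕ
    unblock k = digit f (n b) (blockLength n b) (fromℕ< (h′<f′ b)) (k ∸ n b)
      where b = block k

    unblock-bounded : Bounded f unblock
    unblock-bounded k = subst (λ k′ → unblock k < f k′) (m+[n∸m]≡n lo)
                              (digit-< f _ _ _ (∸-monoˡ-< hi lo))
      where
      lo = proj₁ (block-bounds k)
      hi = proj₂ (block-bounds k)

    unblock-digit : ∀ {i t} → t < blockLength n i →
                    unblock (n i + t) ≡ digit f (n i) (blockLength n i) (fromℕ< (h′<f′ i)) t
    unblock-digit {i} {t} t<l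
      rewrite block-unique (m≤m+n (n i) t) (offset-in-block t<l) | m+n∸m≡n (n i) t = refl

    unblock-caught : ∀ {g} {B : Slalom g} → unblock ∈Sl B → ∀ i → h′ i ∈ blockSlalom f n B at i
    unblock-caught {B = B} h∈B i =
      subst (_∈ blockSlalom f n B at i) (toℕ-fromℕ< (h′<f′ i)) (blockSlalom-∋ f n B i _ λ {t} t<l →
        subst (_∈ B at (n i + t)) (unblock-digit t<l) (h∈B (n i + t)))

  blockProd-CLe : ∀ g → CLe (blockProd f n) (blockProd g n) f g
  blockProd-CLe g I S S-covers = I , id , id , blockSlalom f n ∘ S , covers
    where
    covers : Covers (blockProd f n) (blockProd g n) (blockSlalom f n ∘ S)
    covers h′ h′<f′ =
      let (i , h∈S) = S-covers (unblock h′ h′<f′) (unblock-bounded h′ h′<f′)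
      in i , unblock-caught h′ h′<f′ h∈S

corollary1p9 : (f g : ℕ → ℕ) → ((k : ℕ) → 0 < g k) → ((k : ℕ) → g k < f k) →
    (n : ℕ → ℕ) → n 0 ≡ 0 → ((i : ℕ) → n i < n (suc i)) →
    CLe (blockProd f n) (blockProd g n) f g
corollary1p9 f g _ _ n n-zero n-strict = blockProd-CLe f n n-zero n-strict g
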